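{- Let $\mathcal{F}$ be a family of graphs and $k\in\mathbb{N}$ such that every $(\mathcal{F}\cup\{K_3\})$-free graph has chromatic number at most $k$. Then every $(\mathcal{F}\cup\{\text{bull},\text{diamond}\})$-free graph $G$ satisfies $\chi(G)\le\max\{2k,\omega(G)\}$.
   Context: Graphs are finite, simple, undirected. A graph is $\mathcal{F}$-free if no member of $\mathcal{F}$ is isomorphic to an induced subgraph of it. A bull is a triangle with two pendant edges attached at two different vertices of the triangle; a diamond is $K_4$ minus one edge. $\chi$ is the chromatic number and $\omega$ the clique number. -}

module Defs where

open import Data.Nat using (ℕ; _≤_; _⊔_; _*_)
open import Data.Fin using (Fin; zero; suc)
open import Data.Bool using (Bool; true; false)
open import Data.Sum using (_⊎_)
open import Data.Product using (Σ; _×_)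
open import Relation.Nullary using (¬_)
open import Relation.Binary.PropositionalEquality using (_≡_; _≢_)
open import Function.Definitions using (Injective)

record Graph : Set where
  field
    n     : ℕ
    adj   : Fin n → Fin n → Bool
    sym   : ∀ i j → adj i j ≡ adj j i
    irrefl : ∀ i → adj i i ≡ false
open Graph public

Induced : Graph → Graph → Set
Induced H G =
  Σ (Fin (n H) → Fin (n G)) λ f →
    Injective _≡_ _≡_ f × (∀ i j → adj G (f i) (f j) ≡ adj H i j)

Family : Set₁
Family = Graph → Set

_∪_ : Family → Family → Family
(F ∪ F') H = F H ⊎ F' H

⟦_⟧ : Graph → Family
⟦ H₀ ⟧ H = H ≡ H₀

Free : Family → Graph → Set
Free F G = ∀ H → F H → ¬ Induced H G

Colourable : Graph → ℕ → Set
Colourable G c =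
  Σ (Fin (n G) → Fin c) λ col → ∀ i j → adj G i j ≡ true → col i ≢ col j

HasClique : Graph → ℕ → Set
HasClique G s =
  Σ (Fin s → Fin (n G)) λ f →
    Injective _≡_ _≡_ f × (∀ i j → i ≢ j → adj G (f i) (f j) ≡ true)

IsCliqueNumber : Graph → ℕ → Set
IsCliqueNumber G w = HasClique G w × (∀ s → HasClique G s → s ≤ w)

k3adj : Fin 3 → Fin 3 → Bool
k3adj zero zero = false
k3adj (suc zero) (suc zero) = false
k3adj (suc (suc zero)) (suc (suc zero)) = false
k3adj _ _ = true

K3 : Graph
K3 = record { n = 3 ; adj = k3adj ; sym = s ; irrefl = r }
  where
  s : ∀ i j → k3adj i j ≡ k3adj j i
  s zero zero = _≡_.refl
  s zero (suc zero) = _≡_.refl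
  s zero (suc (suc zero)) = _≡_.refl
  s (suc zero) zero = _≡_.refl
  s (suc zero) (suc zero) = _≡_.refl
  s (suc zero) (suc (suc zero)) = _≡_.refl
  s (suc (suc zero)) zero = _≡_.refl
  s (suc (suc zero)) (suc zero) = _≡_.refl
  s (suc (suc zero)) (suc (suc zero)) = _≡_.refl
  r : ∀ i → k3adj i i ≡ false
  r zero = _≡_.refl
  r (suc zero) = _≡_.refl
  r (suc (suc zero)) = _≡_.refl

open import Data.Fin using (toℕ)
open import Data.Nat using (_≡ᵇ_)
open import Data.Bool using (_∧_; _∨_; if_then_else_)

-- Diamond = K4 minus the edge {2,3}: vertices 0,1,2,3; edges 01,02,03,12,13.
diamondAdj : Fin 4 → Fin 4 → Bool
diamondAdj i j = e (toℕ i) (toℕ j)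
  where
  e : ℕ → ℕ → Bool
  e a b = if a ≡ᵇ b then false else
          (if (a ≡ᵇ 2) ∧ (b ≡ᵇ 3) then false else
          (if (a ≡ᵇ 3) ∧ (b ≡ᵇ 2) then false else true))

-- Bull: triangle 0,1,2 with pendant vertex 3 adjacent to 0 and 4 adjacent to 1.
bullEdge : ℕ → ℕ → Bool
bullEdge a b = ((a ≡ᵇ 0) ∧ (b ≡ᵇ 1)) ∨ ((a ≡ᵇ 0) ∧ (b ≡ᵇ 2)) ∨ ((a ≡ᵇ 1) ∧ (b ≡ᵇ 2))
          ∨ ((a ≡ᵇ 0) ∧ (b ≡ᵇ 3)) ∨ ((a ≡ᵇ 1) ∧ (b ≡ᵇ 4))

bullAdj : Fin 5 → Fin 5 → Bool
bullAdj i j = bullEdge (toℕ i) (toℕ j) ∨ bullEdge (toℕ j) (toℕ i)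

Diamond : Graph
Diamond = record { n = 4 ; adj = diamondAdj ; sym = s ; irrefl = r }
  where
  s : ∀ i j → diamondAdj i j ≡ diamondAdj j i
  s zero zero = _≡_.refl
  s zero (suc zero) = _≡_.refl
  s zero (suc (suc zero)) = _≡_.refl
  s zero (suc (suc (suc zero))) = _≡_.refl
  s (suc zero) zero = _≡_.refl
  s (suc zero) (suc zero) = _≡_.refl
  s (suc zero) (suc (suc zero)) = _≡_.refl
  s (suc zero) (suc (suc (suc zero))) = _≡_.refl
  s (suc (suc zero)) zero = _≡_.refl
  s (suc (suc zero)) (suc zero) = _≡_.refl
  s (suc (suc zero)) (suc (suc zero)) = _≡_.refl
  s (suc (suc zero)) (suc (suc (suc zero))) = _≡_.refl
  s (suc (suc (suc zero))) zero = _≡_.refl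
  s (suc (suc (suc zero))) (suc zero) = _≡_.refl
  s (suc (suc (suc zero))) (suc (suc zero)) = _≡_.refl
  s (suc (suc (suc zero))) (suc (suc (suc zero))) = _≡_.refl
  r : ∀ i → diamondAdj i i ≡ false
  r zero = _≡_.refl
  r (suc zero) = _≡_.refl
  r (suc (suc zero)) = _≡_.refl
  r (suc (suc (suc zero))) = _≡_.refl

open import Data.Bool.Properties using (∨-comm)

Bull : Graph
Bull = record { n = 5 ; adj = bullAdj ; sym = s ; irrefl = r }
  where
  s : ∀ i j → bullAdj i j ≡ bullAdj j i
  s i j = ∨-comm (bullEdge (toℕ i) (toℕ j)) (bullEdge (toℕ j) (toℕ i))
  r : ∀ i → bullAdj i i ≡ false
  r zero = _≡_.refl
  r (suc zero) = _≡_.refl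
  r (suc (suc zero)) = _≡_.refl
  r (suc (suc (suc zero))) = _≡_.refl
  r (suc (suc (suc (suc zero)))) = _≡_.refl

{-# OPTIONS --safe #-}
-- Triangle-free graphs are coloured by hypothesis; otherwise extend a triangle to a maximal
-- clique Q, of size at most ω ≤ c, and colour G − a by induction for a suitable a ∈ Q.
-- If some a ∈ Q has no neighbour outside Q, its |Q| − 1 < c neighbours leave a colour free.
-- Otherwise diamond-freeness makes each outside vertex adjacent to at most one vertex of Q,
-- and bull-freeness makes outside neighbours of distinct clique vertices adjacent; so two
-- clique vertices a, b have unique outside neighbours u_a ~ u_b. Let f be the colour missing
-- on Q − a: colour a with f, unless u_a has colour f; then give a the colour of b and
-- recolour b with f, which u_b, being adjacent to u_a, does not have.
-- Only c ≥ max(k, ω) is used, not c ≥ 2k.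
module Submission where

open import Defs
open import Data.Nat as ℕ using (ℕ; zero; suc; _+_; _*_; _⊔_; _≤_; z≤n; s≤s)
import Data.Nat.Properties as ℕₚ
open import Data.Fin as Fin using (Fin; zero; suc; #_; punchIn; punchOut; inject≤; fromℕ<; _≟_)
import Data.Fin.Properties as Finₚ
open import Data.Vec.Functional using ([]; _∷_; updateAt)
open import Data.Vec.Functional.Properties using (updateAt-updates; updateAt-minimal)
open import Data.Bool using (true; false) renaming (_≟_ to _≟ᵇ_)
open import Data.Bool.Properties using (¬-not)
open import Data.Product using (Σ; ∃-syntax; _×_; _,_; proj₁; proj₂; map₂)
open import Data.Sum using (_⊎_; inj₁; inj₂)
open import Data.Empty using (⊥-elim)
open import Function using (_∘_; const; case_of_)
open import Function.Definitions using (Injective)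
open import Level using (0ℓ)
open import Relation.Binary.Definitions using (tri<; tri≈; tri>)
open import Relation.Binary.PropositionalEquality as ≡
  using (_≡_; _≢_; refl; cong; trans; subst; subst₂; ≢-sym)
open import Relation.Nullary using (¬_; Dec; yes; no; contradiction)
open import Relation.Nullary.Decidable using (from-yes; ¬?; _×-dec_; _⊎-dec_; _→-dec_)
open import Relation.Unary using (Pred; ∅; ｛_｝; _∉_)

missing-colour : ∀ {m c} → m ℕ.< c → (g : Fin m → Fin c) → ∃[ γ ] ∀ t → g t ≢ γ
missing-colour {m} {c} m<c g with Finₚ.any? (λ γ → Finₚ.all? (λ t → ¬? (g t ≟ γ)))
... | yes missed = missed
... | no all-hit = ⊥-elim (Finₚ.<⇒notInjective m<c section-injective)
  where
  preimage : ∀ γ → ∃[ t ] g t ≡ γ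
  preimage γ with Finₚ.any? (λ t → g t ≟ γ)
  ... | yes hit = hit
  ... | no ¬hit = contradiction (γ , λ t e → ¬hit (t , e)) all-hit

  section-injective : Injective _≡_ _≡_ (proj₁ ∘ preimage)
  section-injective {γ} {δ} e =
    trans (≡.sym (proj₂ (preimage γ))) (trans (cong g e) (proj₂ (preimage δ)))

missing-colour-except : ∀ {m c} (i : Fin (suc m)) → m ℕ.< c → (g : Fin (suc m) → Fin c) →
                        ∃[ γ ] ∀ t → t ≢ i → g t ≢ γ
missing-colour-except i m<c g with γ , missed ← missing-colour m<c (g ∘ punchIn i) = γ , avoids
  where
  avoids : ∀ t → t ≢ i → g t ≢ γ
  avoids t t≢i =
    subst (λ s → g s ≢ γ) (Finₚ.punchIn-punchOut (≢-sym t≢i)) (missed (punchOut (≢-sym t≢i)))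

≢-by-< : ∀ {m} (R : Fin m → Fin m → Set) → (∀ {i j} → R i j → R j i) →
         (∀ {i j} → i Fin.< j → R i j) → ∀ {i j} → i ≢ j → R i j
≢-by-< R R-sym R-< {i} {j} i≢j with Finₚ.<-cmp i j
... | tri< i<j _ _ = R-< i<j
... | tri≈ _ i≡j _ = contradiction i≡j i≢j
... | tri> _ _ j<i = R-sym (R-< j<i)

module Adjacency (G : Graph) where

  V : Set
  V = Fin (n G)

  _~_ _≁_ : V → V → Set
  x ~ y = adj G x y ≡ true
  x ≁ y = adj G x y ≡ false

  ~-sym : ∀ {x y} → x ~ y → y ~ x
  ~-sym {x} {y} x~y = trans (sym G y x) x~y

  ~⇒≢ : ∀ {x y} → x ~ y → x ≢ y
  ~⇒≢ {x} x~x refl with () ← trans (≡.sym x~x) (irrefl G x)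

  ~-≁⇒≢ : ∀ {x y z} → x ~ z → y ≁ z → x ≢ y
  ~-≁⇒≢ x~z x≁z refl with () ← trans (≡.sym x~z) x≁z

  IsClique : ∀ {m} → (Fin m → V) → Set
  IsClique Q = ∀ i j → i ≢ j → Q i ~ Q j

  clique⇒injective : ∀ {m} {Q : Fin m → V} → IsClique Q → Injective _≡_ _≡_ Q
  clique⇒injective {Q = Q} clique {i} {j} Qi≡Qj with i ≟ j
  ... | yes i≡j = i≡j
  ... | no i≢j = contradiction Qi≡Qj (~⇒≢ (clique i j i≢j))

  Outside : ∀ {m} → (Fin m → V) → V → Set
  Outside Q u = ∀ i → Q i ≢ u

  inside-or-outside : ∀ {m} (Q : Fin m → V) u → (∃[ t ] Q t ≡ u) ⊎ Outside Q u
  inside-or-outside Q u with Finₚ.any? (λ t → Q t ≟ u)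
  ... | yes inside = inj₁ inside
  ... | no ¬inside = inj₂ (λ t Qt≡u → ¬inside (t , Qt≡u))

  OutsideNeighbour : ∀ {m} → (Fin m → V) → Fin m → V → Set
  OutsideNeighbour Q i u = Outside Q u × Q i ~ u

  outside-neighbour? : ∀ {m} (Q : Fin m → V) i → Dec (∃[ u ] OutsideNeighbour Q i u)
  outside-neighbour? Q i =
    Finₚ.any? λ u → Finₚ.all? (λ t → ¬? (Q t ≟ u)) ×-dec (adj G (Q i) u ≟ᵇ true)

  neighbour-inside-or-outside : ∀ {m} (Q : Fin m → V) {i y} → Q i ~ y →
                                (∃[ t ] t ≢ i × Q t ≡ y) ⊎ OutsideNeighbour Q i y
  neighbour-inside-or-outside Q {i} {y} Qi~y with inside-or-outside Q y
  ... | inj₁ (t , refl) = inj₁ (t , (λ t≡i → ~⇒≢ Qi~y (cong Q (≡.sym t≡i))) , refl)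
  ... | inj₂ outside   = inj₂ (outside , Qi~y)

  IsMaximal : ∀ {m} → (Fin m → V) → Set
  IsMaximal Q = ∀ u → ∃[ i ] Q i ≁ u

  record MaximalClique : Set where
    field
      size    : ℕ
      vertex  : Fin size → V
      clique  : IsClique vertex
      maximal : IsMaximal vertex

  maximal-or-extendable : ∀ {m} (Q : Fin m → V) → IsMaximal Q ⊎ ∃[ u ] ∀ i → Q i ~ u
  maximal-or-extendable Q with Finₚ.any? (λ u → Finₚ.all? (λ i → adj G (Q i) u ≟ᵇ true))
  ... | yes extendable = inj₂ extendable
  ... | no ¬extendable = inj₁ λ u →
    map₂ ¬-not (Finₚ.¬∀⟶∃¬ _ _ (λ i → adj G (Q i) u ≟ᵇ true) (¬extendable ∘ (u ,_)))

  ∷-clique : ∀ {m u} {Q : Fin m → V} → IsClique Q → (∀ i → Q i ~ u) → IsClique (u ∷ Q)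
  ∷-clique clique u~Q zero    zero    0≢0 = contradiction refl 0≢0
  ∷-clique clique u~Q zero    (suc j) _   = ~-sym (u~Q j)
  ∷-clique clique u~Q (suc i) zero    _   = u~Q i
  ∷-clique clique u~Q (suc i) (suc j) i≢j = clique i j (i≢j ∘ cong suc)

  -- d is fuel: a clique is injective, so once n G ≤ m it admits no extension.
  extend-to-maximal : ∀ d {m} (Q : Fin m → V) → IsClique Q → n G ≤ d + m →
                      Σ MaximalClique λ K → m ≤ MaximalClique.size K
  extend-to-maximal zero Q clique n≤m with maximal-or-extendable Q
  ... | inj₁ maximal = record { clique = clique ; maximal = maximal } , ℕₚ.≤-refl
  ... | inj₂ (u , u~Q) =
    contradiction n≤m (ℕₚ.<⇒≱ (Finₚ.injective⇒≤ (clique⇒injective (∷-clique clique u~Q))))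
  extend-to-maximal (suc d) {m} Q clique n≤1+d+m with maximal-or-extendable Q
  ... | inj₁ maximal = record { clique = clique ; maximal = maximal } , ℕₚ.≤-refl
  ... | inj₂ (u , u~Q) = map₂ ℕₚ.<⇒≤ (extend-to-maximal d (u ∷ Q) (∷-clique clique u~Q)
                           (subst (n G ≤_) (≡.sym (ℕₚ.+-suc d m)) n≤1+d+m))

  Triangle : Set
  Triangle = ∃[ x ] ∃[ y ] ∃[ z ] x ~ y × y ~ z × x ~ z

  triangle? : Dec Triangle
  triangle? = Finₚ.any? λ x → Finₚ.any? λ y → Finₚ.any? λ z →
    (adj G x y ≟ᵇ true) ×-dec (adj G y z ≟ᵇ true) ×-dec (adj G x z ≟ᵇ true)

  triangle-clique : ((x , y , z , _) : Triangle) → IsClique (x ∷ y ∷ z ∷ [])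
  triangle-clique (x , y , z , x~y , y~z , x~z) i j =
    ≢-by-< (λ i j → Q i ~ Q j) ~-sym upper
    where
    Q : Fin 3 → V
    Q = x ∷ y ∷ z ∷ []
    upper : ∀ {i j} → i Fin.< j → Q i ~ Q j
    upper {zero}     {suc zero}       _                 = x~y
    upper {zero}     {suc (suc zero)} _                 = x~z
    upper {suc zero} {suc (suc zero)} _                 = y~z
    upper {_}        {zero}           ()
    upper {suc _}    {suc zero}       (s≤s ())
    upper {suc (suc _)} {suc (suc zero)} (s≤s (s≤s ()))

  ¬Triangle⇒K3-free : ¬ Triangle → ¬ Induced K3 G
  ¬Triangle⇒K3-free ¬triangle (f , _ , f-adj) =
    ¬triangle (f (# 0) , f (# 1) , f (# 2) , f-adj (# 0) (# 1) , f-adj (# 1) (# 2) , f-adj (# 0) (# 2))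

Twins : (H : Graph) → Fin (n H) → Fin (n H) → Set
Twins H i j = ∀ z → adj H i z ≡ adj H j z

bull-twin-free : ∀ i j → Twins Bull i j → i ≡ j
bull-twin-free = from-yes (Finₚ.all? λ i → Finₚ.all? λ j →
  Finₚ.all? (λ z → adj Bull i z ≟ᵇ adj Bull j z) →-dec (i ≟ j))

diamond-twins : ∀ i j → Twins Diamond i j → i ≡ j ⊎ (i ≡ # 2 × j ≡ # 3) ⊎ (i ≡ # 3 × j ≡ # 2)
diamond-twins = from-yes (Finₚ.all? λ i → Finₚ.all? λ j →
  Finₚ.all? (λ z → adj Diamond i z ≟ᵇ adj Diamond j z) →-dec
  ((i ≟ j) ⊎-dec ((i ≟ # 2) ×-dec (j ≟ # 3)) ⊎-dec ((i ≟ # 3) ×-dec (j ≟ # 2))))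

module _ (H G : Graph) (f : Fin (n H) → Fin (n G)) where

  adjacency-by-< : (∀ {i j} → i Fin.< j → adj G (f i) (f j) ≡ adj H i j) →
                   ∀ i j → adj G (f i) (f j) ≡ adj H i j
  adjacency-by-< upper i j with i ≟ j
  ... | yes refl = trans (irrefl G (f i)) (≡.sym (irrefl H i))
  ... | no i≢j = ≢-by-< (λ i j → adj G (f i) (f j) ≡ adj H i j) swap upper i≢j
    where
    swap : ∀ {i j} → adj G (f i) (f j) ≡ adj H i j → adj G (f j) (f i) ≡ adj H j i
    swap {i} {j} e = trans (sym G (f j) (f i)) (trans e (sym H i j))

  -- Adjacency preservation forces identified vertices to be twins, so an embedding
  -- need only be checked to separate twins.
  induced-by-separation : (∀ i j → adj G (f i) (f j) ≡ adj H i j) →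
                          (∀ {i j} → i ≢ j → Twins H i j → f i ≢ f j) → Induced H G
  induced-by-separation f-adj separated = f , injective , f-adj
    where
    twins : ∀ {i j} → f i ≡ f j → Twins H i j
    twins {i} {j} fi≡fj z =
      trans (≡.sym (f-adj i z)) (trans (cong (λ x → adj G x (f z)) fi≡fj) (f-adj j z))

    injective : Injective _≡_ _≡_ f
    injective {i} {j} fi≡fj with i ≟ j
    ... | yes i≡j = i≡j
    ... | no i≢j = contradiction fi≡fj (separated i≢j (twins fi≡fj))

module _ (G : Graph) where
  open Adjacency G

  induced-diamond : ∀ {p q r s} → p ~ q → p ~ r → p ~ s → q ~ r → q ~ s → r ≁ s → r ≢ s →
                    Induced Diamond G
  induced-diamond {p} {q} {r} {s} p~q p~r p~s q~r q~s r≁s r≢s =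
    induced-by-separation Diamond G f (adjacency-by-< Diamond G f upper) separated
    where
    f : Fin 4 → V
    f = p ∷ q ∷ r ∷ s ∷ []

    upper : ∀ {i j} → i Fin.< j → adj G (f i) (f j) ≡ adj Diamond i j
    upper {zero}          {suc zero}             _ = p~q
    upper {zero}          {suc (suc zero)}       _ = p~r
    upper {zero}          {suc (suc (suc zero))} _ = p~s
    upper {suc zero}      {suc (suc zero)}       _ = q~r
    upper {suc zero}      {suc (suc (suc zero))} _ = q~s
    upper {suc (suc zero)} {suc (suc (suc zero))} _ = r≁s
    upper {_}             {zero}                 ()
    upper {suc _}         {suc zero}             (s≤s ())
    upper {suc (suc _)}   {suc (suc zero)}       (s≤s (s≤s ()))
    upper {suc (suc (suc _))} {suc (suc (suc zero))} (s≤s (s≤s (s≤s ())))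

    separated : ∀ {i j} → i ≢ j → Twins Diamond i j → f i ≢ f j
    separated {i} {j} i≢j twins with diamond-twins i j twins
    ... | inj₁ i≡j = contradiction i≡j i≢j
    ... | inj₂ (inj₁ (refl , refl)) = r≢s
    ... | inj₂ (inj₂ (refl , refl)) = ≢-sym r≢s

  induced-bull : ∀ {t₀ t₁ t₂ p₃ p₄} →
                 t₀ ~ t₁ → t₀ ~ t₂ → t₀ ~ p₃ → t₀ ≁ p₄ → t₁ ~ t₂ → t₁ ≁ p₃ → t₁ ~ p₄ →
                 t₂ ≁ p₃ → t₂ ≁ p₄ → p₃ ≁ p₄ → Induced Bull G
  induced-bull {t₀} {t₁} {t₂} {p₃} {p₄} e01 e02 e03 e04 e12 e13 e14 e23 e24 e34 =
    induced-by-separation Bull G f (adjacency-by-< Bull G f upper)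
      (λ i≢j twins → contradiction (bull-twin-free _ _ twins) i≢j)
    where
    f : Fin 5 → V
    f = t₀ ∷ t₁ ∷ t₂ ∷ p₃ ∷ p₄ ∷ []

    upper : ∀ {i j} → i Fin.< j → adj G (f i) (f j) ≡ adj Bull i j
    upper {zero}    {suc zero}                   _ = e01
    upper {zero}    {suc (suc zero)}             _ = e02
    upper {zero}    {suc (suc (suc zero))}       _ = e03
    upper {zero}    {suc (suc (suc (suc zero)))} _ = e04
    upper {suc zero} {suc (suc zero)}             _ = e12
    upper {suc zero} {suc (suc (suc zero))}       _ = e13
    upper {suc zero} {suc (suc (suc (suc zero)))} _ = e14
    upper {suc (suc zero)} {suc (suc (suc zero))}       _ = e23
    upper {suc (suc zero)} {suc (suc (suc (suc zero)))} _ = e24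
    upper {suc (suc (suc zero))} {suc (suc (suc (suc zero)))} _ = e34
    upper {_}       {zero}                       ()
    upper {suc _}   {suc zero}                   (s≤s ())
    upper {suc (suc _)} {suc (suc zero)}         (s≤s (s≤s ()))
    upper {suc (suc (suc _))} {suc (suc (suc zero))} (s≤s (s≤s (s≤s ())))
    upper {suc (suc (suc (suc _)))} {suc (suc (suc (suc zero)))} (s≤s (s≤s (s≤s (s≤s ()))))

_[_] : (G : Graph) → ∀ {m} → (Fin m → Fin (n G)) → Graph
G [ ι ] = record
  { n      = _
  ; adj    = λ i j → adj G (ι i) (ι j)
  ; sym    = λ i j → sym G (ι i) (ι j)
  ; irrefl = λ i → irrefl G (ι i)
  }

module _ {G : Graph} {m} {ι : Fin m → Fin (n G)} (ι-injective : Injective _≡_ _≡_ ι) where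

  Induced-[] : ∀ {H} → Induced H (G [ ι ]) → Induced H G
  Induced-[] (f , f-injective , f-adj) = ι ∘ f , f-injective ∘ ι-injective , f-adj

  Free-[] : ∀ {F} → Free F G → Free F (G [ ι ])
  Free-[] free H FH embedding = free H FH (Induced-[] {H} embedding)

  HasClique-[] : ∀ {s} → HasClique (G [ ι ]) s → HasClique G s
  HasClique-[] (f , f-injective , f-clique) = ι ∘ f , f-injective ∘ ι-injective , f-clique

Free-∪-⟦⟧ : ∀ {F F′ H} G → Free (F ∪ F′) G → ¬ Induced H G → Free (F ∪ ⟦ H ⟧) G
Free-∪-⟦⟧ G free ¬induced H′ (inj₁ FH′) = free H′ (inj₁ FH′)
Free-∪-⟦⟧ G free ¬induced _  (inj₂ refl) = ¬induced

Colourable-≤ : ∀ {G k c} → k ≤ c → Colourable G k → Colourable G c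
Colourable-≤ k≤c (col , proper) =
  (λ x → inject≤ (col x) k≤c) ,
  (λ x y x~y e → proper x y x~y (Finₚ.inject≤-injective k≤c k≤c _ _ e))

ProperAway : (G : Graph) {c : ℕ} → Pred (Fin (n G)) 0ℓ → (Fin (n G) → Fin c) → Set
ProperAway G X col = ∀ x y → x ∉ X → y ∉ X → adj G x y ≡ true → col x ≢ col y

module _ (G : Graph) {c : ℕ} where
  open Adjacency G

  ProperAway-∅⇒Colourable : ∀ {col : V → Fin c} → ProperAway G ∅ col → Colourable G c
  ProperAway-∅⇒Colourable {col} proper = col , λ x y → proper x y (λ ()) (λ ())

  updateAt-elsewhere : ∀ {v z} {γ : Fin c} (col : V → Fin c) → v ≢ z →
                       updateAt col v (const γ) z ≡ col z
  updateAt-elsewhere {v} {z} col v≢z = updateAt-minimal z v col (≢-sym v≢z)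

  recolour : ∀ {X v γ} {col : V → Fin c} → ProperAway G ｛ v ｝ col →
             (∀ y → v ~ y → y ∉ X → col y ≢ γ) → ProperAway G X (updateAt col v (const γ))
  recolour {X} {v} {γ} {col} away fresh x y x∉X y∉X x~y with v ≟ x | v ≟ y
  ... | yes refl | yes refl = contradiction refl (~⇒≢ x~y)
  ... | yes refl | no v≢y   =
    subst₂ _≢_ (≡.sym (updateAt-updates v col)) (≡.sym (updateAt-elsewhere col v≢y))
      (≢-sym (fresh y x~y y∉X))
  ... | no v≢x   | yes refl =
    subst₂ _≢_ (≡.sym (updateAt-elsewhere col v≢x)) (≡.sym (updateAt-updates v col))
      (fresh x (~-sym x~y) x∉X)
  ... | no v≢x   | no v≢y   =
    subst₂ _≢_ (≡.sym (updateAt-elsewhere col v≢x)) (≡.sym (updateAt-elsewhere col v≢y))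
      (away x y v≢x v≢y x~y)

  colouring-away : ∀ {m} (ι : Fin m → V) v → (∀ x → v ≢ x → ∃[ t ] ι t ≡ x) → Fin c →
                   Colourable (G [ ι ]) c → ∃[ col ] ProperAway G {c} ｛ v ｝ col
  colouring-away ι v covered default (col′ , proper′) = col , away
    where
    col : V → Fin c
    col x with v ≟ x
    ... | yes _   = default
    ... | no v≢x  = col′ (proj₁ (covered x v≢x))

    away : ProperAway G ｛ v ｝ col
    away x y v≢x v≢y x~y with v ≟ x | v ≟ y
    ... | yes v≡x | _       = contradiction v≡x v≢x
    ... | no _    | yes v≡y = contradiction v≡y v≢y
    ... | no v≢x′ | no v≢y′ with covered x v≢x′ | covered y v≢y′
    ...   | t , refl | s , refl = proper′ t s x~y

module BullDiamondFree (G : Graph) (bull-free : ¬ Induced Bull G) (diamond-free : ¬ Induced Diamond G)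
  where
  open Adjacency G

  module MaximalCliqueStructure {m} {Q : Fin m → V} (clique : IsClique Q) (maximal : IsMaximal Q) where

    outside-neighbour-private : ∀ {i j u} → OutsideNeighbour Q i u → i ≢ j → Q j ≁ u
    outside-neighbour-private {i} {j} {u} (outside , Qi~u) i≢j with adj G (Q j) u in Qj-u
    ... | false = refl
    ... | true  = contradiction
      (induced-diamond G (clique i j i≢j) (clique i z (i≢z ∘ cong Q)) Qi~u
                         (clique j z (j≢z ∘ cong Q)) Qj-u Qz≁u (outside z))
      diamond-free
      where
      z : Fin m
      z = proj₁ (maximal u)
      Qz≁u : Q z ≁ u
      Qz≁u = proj₂ (maximal u)
      i≢z : Q i ≢ Q z
      i≢z = ~-≁⇒≢ Qi~u Qz≁u
      j≢z : Q j ≢ Q z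
      j≢z = ~-≁⇒≢ Qj-u Qz≁u

    outside-neighbours-adjacent : ∀ {i j k u u′} → i ≢ j → i ≢ k → j ≢ k →
                                  OutsideNeighbour Q i u → OutsideNeighbour Q j u′ → u ~ u′
    outside-neighbours-adjacent {i} {j} {k} {u} {u′} i≢j i≢k j≢k nu nu′ with adj G u u′ in u-u′
    ... | true  = refl
    ... | false = contradiction
      (induced-bull G (clique i j i≢j) (clique i k i≢k) (proj₂ nu)
                      (outside-neighbour-private nu′ (≢-sym i≢j)) (clique j k j≢k)
                      (outside-neighbour-private nu i≢j) (proj₂ nu′)
                      (outside-neighbour-private nu i≢k) (outside-neighbour-private nu′ j≢k) u-u′)
      bull-free

    -- If u ≢ uᵢ, then {uᵢ, u, Q i, uⱼ} induces a diamond when u ~ uᵢ, and {uⱼ, uₖ, uᵢ, u} when not.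
    outside-neighbour-unique : ∀ {i j k uᵢ uⱼ uₖ u} → i ≢ j → i ≢ k → j ≢ k →
                               OutsideNeighbour Q i uᵢ → OutsideNeighbour Q j uⱼ →
                               OutsideNeighbour Q k uₖ → OutsideNeighbour Q i u → u ≡ uᵢ
    outside-neighbour-unique {i} {j} {k} {uᵢ} {uⱼ} {uₖ} {u} i≢j i≢k j≢k nᵢ nⱼ nₖ n with u ≟ uᵢ
    ... | yes u≡uᵢ = u≡uᵢ
    ... | no u≢uᵢ with adj G uᵢ u in uᵢ-u
    ...   | true  = contradiction
      (induced-diamond G uᵢ-u (~-sym (proj₂ nᵢ)) (adjacent i≢j i≢k j≢k nᵢ nⱼ) (~-sym (proj₂ n))
                         (adjacent i≢j i≢k j≢k n nⱼ) (outside-neighbour-private nⱼ (≢-sym i≢j))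
                         (proj₁ nⱼ i))
      diamond-free
      where adjacent = outside-neighbours-adjacent
    ...   | false = contradiction
      (induced-diamond G (adjacent j≢k (≢-sym i≢j) (≢-sym i≢k) nⱼ nₖ)
                         (~-sym (adjacent i≢j i≢k j≢k nᵢ nⱼ)) (~-sym (adjacent i≢j i≢k j≢k n nⱼ))
                         (~-sym (adjacent i≢k i≢j (≢-sym j≢k) nᵢ nₖ))
                         (~-sym (adjacent i≢k i≢j (≢-sym j≢k) n nₖ)) uᵢ-u (≢-sym u≢uᵢ))
      diamond-free
      where adjacent = outside-neighbours-adjacent

  module _ {c r} {Q : Fin (3 + r) → V} (clique : IsClique Q) (maximal : IsMaximal Q)
           (Q-fits : 3 + r ≤ c) (away : ∀ v → ∃[ col ] ProperAway G {c} ｛ v ｝ col) where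
    open MaximalCliqueStructure clique maximal

    colourable-without-outside-neighbour : ∀ i → ¬ (∃[ u ] OutsideNeighbour Q i u) → Colourable G c
    colourable-without-outside-neighbour i none = ProperAway-∅⇒Colourable G (recolour G col-away fresh)
      where
      col : V → Fin c
      col = proj₁ (away (Q i))
      col-away : ProperAway G ｛ Q i ｝ col
      col-away = proj₂ (away (Q i))
      γ : Fin c
      γ = proj₁ (missing-colour-except i Q-fits (col ∘ Q))
      γ-fresh : ∀ t → t ≢ i → col (Q t) ≢ γ
      γ-fresh = proj₂ (missing-colour-except i Q-fits (col ∘ Q))

      fresh : ∀ y → Q i ~ y → y ∉ ∅ → col y ≢ γ
      fresh y Qi~y _ with neighbour-inside-or-outside Q Qi~y
      ... | inj₁ (t , t≢i , refl) = γ-fresh t t≢i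
      ... | inj₂ outside-neighbour = contradiction (y , outside-neighbour) none

    module _ {ua ub uc} (na : OutsideNeighbour Q (# 0) ua) (nb : OutsideNeighbour Q (# 1) ub)
             (nc : OutsideNeighbour Q (# 2) uc) where
      private
        a b : V
        a = Q (# 0)
        b = Q (# 1)
        col : V → Fin c
        col = proj₁ (away a)
        col-away : ProperAway G ｛ a ｝ col
        col-away = proj₂ (away a)
        f : Fin c
        f = proj₁ (missing-colour-except (# 0) Q-fits (col ∘ Q))
        f-fresh : ∀ t → t ≢ # 0 → col (Q t) ≢ f
        f-fresh = proj₂ (missing-colour-except (# 0) Q-fits (col ∘ Q))
        β : Fin c
        β = col b
        β≢f : β ≢ f
        β≢f = f-fresh (# 1) (λ ())

        ua-unique : ∀ {u} → OutsideNeighbour Q (# 0) u → u ≡ ua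
        ua-unique = outside-neighbour-unique (λ ()) (λ ()) (λ ()) na nb nc
        ub-unique : ∀ {u} → OutsideNeighbour Q (# 1) u → u ≡ ub
        ub-unique = outside-neighbour-unique (λ ()) (λ ()) (λ ()) nb na nc

        f-fresh-for-a : col ua ≢ f → ∀ y → a ~ y → y ∉ ∅ → col y ≢ f
        f-fresh-for-a ua≢f y a~y _ with neighbour-inside-or-outside Q a~y
        ... | inj₁ (t , t≢0 , refl) = f-fresh t t≢0
        ... | inj₂ n = subst (λ u → col u ≢ f) (≡.sym (ua-unique n)) ua≢f

        β-fresh-for-a : col ua ≡ f → ∀ y → a ~ y → y ∉ ｛ b ｝ → col y ≢ β
        β-fresh-for-a ua≡f y a~y b≢y with neighbour-inside-or-outside Q a~y
        ... | inj₁ (t , t≢0 , refl) =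
          col-away y b (~⇒≢ a~y) (~⇒≢ (clique (# 0) (# 1) (λ ())))
                   (clique t (# 1) (b≢y ∘ cong Q ∘ ≡.sym))
        ... | inj₂ n = subst (λ u → col u ≢ β) (≡.sym (ua-unique n))
                         (λ ua≡β → β≢f (trans (≡.sym ua≡β) ua≡f))

        ub-avoids-f : col ua ≡ f → col ub ≢ f
        ub-avoids-f ua≡f ub≡f = col-away ub ua (proj₁ nb (# 0)) (proj₁ na (# 0))
          (outside-neighbours-adjacent {k = # 2} (λ ()) (λ ()) (λ ()) nb na) (trans ub≡f (≡.sym ua≡f))

        f-fresh-for-b : col ua ≡ f → ∀ y → b ~ y → y ∉ ∅ → updateAt col a (const β) y ≢ f
        f-fresh-for-b ua≡f y b~y _ with a ≟ y
        ... | yes refl = subst (_≢ f) (≡.sym (updateAt-updates a col)) β≢f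
        ... | no a≢y with neighbour-inside-or-outside Q b~y
        ...   | inj₁ (t , _ , refl) = subst (_≢ f) (≡.sym (updateAt-elsewhere G col a≢y))
                                        (f-fresh t (a≢y ∘ cong Q ∘ ≡.sym))
        ...   | inj₂ n rewrite ub-unique n = subst (_≢ f) (≡.sym (updateAt-elsewhere G col a≢y))
                                               (ub-avoids-f ua≡f)

      colourable-with-outside-neighbours : Colourable G c
      colourable-with-outside-neighbours = case col ua ≟ f of λ where
        (no  ua≢f) → ProperAway-∅⇒Colourable G (recolour G col-away (f-fresh-for-a ua≢f))
        (yes ua≡f) → ProperAway-∅⇒Colourable G
                       (recolour G (recolour G col-away (β-fresh-for-a ua≡f)) (f-fresh-for-b ua≡f))

    colourable-from-maximal-clique : Colourable G c
    colourable-from-maximal-clique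
      with outside-neighbour? Q (# 0) | outside-neighbour? Q (# 1) | outside-neighbour? Q (# 2)
    ... | no none | _     | _       = colourable-without-outside-neighbour (# 0) none
    ... | yes _   | no none | _     = colourable-without-outside-neighbour (# 1) none
    ... | yes _   | yes _ | no none = colourable-without-outside-neighbour (# 2) none
    ... | yes (_ , na) | yes (_ , nb) | yes (_ , nc) = colourable-with-outside-neighbours na nb nc

  colourable-with-triangle : ∀ {c} → Triangle → (∀ s → HasClique G s → s ≤ c) →
                             (Fin c → ∀ v → ∃[ col ] ProperAway G {c} ｛ v ｝ col) → Colourable G c
  colourable-with-triangle {c} triangle fits away
    with extend-to-maximal (n G) _ (triangle-clique triangle) (ℕₚ.m≤m+n (n G) 3)
  ... | record { vertex = Q ; clique = clique ; maximal = maximal } , s≤s (s≤s (s≤s (z≤n {r}))) =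
    colourable-from-maximal-clique clique maximal Q-fits (away default)
    where
    Q-fits : 3 + r ≤ c
    Q-fits = fits _ (Q , clique⇒injective clique , clique)
    default : Fin c
    default = fromℕ< (ℕₚ.≤-trans (s≤s z≤n) Q-fits)

open Adjacency using (triangle?; ¬Triangle⇒K3-free)

module _ (F : Family) {k c w : ℕ} (k≤c : k ≤ c) (w≤c : w ≤ c)
         (triangle-free-colourable : ∀ G → Free (F ∪ ⟦ K3 ⟧) G → Colourable G k) where

  bull-diamond-free-colourable : ∀ N (G : Graph) → n G ≡ N → Free (F ∪ (⟦ Bull ⟧ ∪ ⟦ Diamond ⟧)) G →
                                 (∀ s → HasClique G s → s ≤ w) → Colourable G c
  bull-diamond-free-colourable zero record { n = .zero } refl _ _ = (λ ()) , (λ ())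
  bull-diamond-free-colourable (suc K) G@record { n = .(suc K) } refl free ω≤w with triangle? G
  ... | no ¬triangle = Colourable-≤ {G} k≤c
                         (triangle-free-colourable G (Free-∪-⟦⟧ G free (¬Triangle⇒K3-free G ¬triangle)))
  ... | yes triangle = BullDiamondFree.colourable-with-triangle G
                         (free Bull (inj₂ (inj₁ refl))) (free Diamond (inj₂ (inj₂ refl))) triangle
                         (λ s clique → ℕₚ.≤-trans (ω≤w s clique) w≤c) away
    where
    away : Fin c → ∀ v → ∃[ col ] ProperAway G {c} ｛ v ｝ col
    away default v =
      colouring-away G (punchIn v) v (λ x v≢x → punchOut v≢x , Finₚ.punchIn-punchOut v≢x) default
        (bull-diamond-free-colourable K (G [ punchIn v ]) refl (Free-[] {G} injective free)
           (λ s → ω≤w s ∘ HasClique-[] {G} injective))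
      where
      injective : Injective _≡_ _≡_ (punchIn v)
      injective = Finₚ.punchIn-injective v _ _

theorem3p2 : (F : Family) (k : ℕ) →
    (∀ G → Free (F ∪ ⟦ K3 ⟧) G → Colourable G k) →
    ∀ G → Free (F ∪ (⟦ Bull ⟧ ∪ ⟦ Diamond ⟧)) G →
    ∀ w → IsCliqueNumber G w → Colourable G ((2 * k) ⊔ w)
theorem3p2 F k triangle-free-colourable G free w (_ , ω-maximum) =
  bull-diamond-free-colourable F k≤c w≤c triangle-free-colourable (n G) G refl free ω-maximum
  where
  k≤c : k ≤ 2 * k ⊔ w
  k≤c = ℕₚ.≤-trans (ℕₚ.m≤m+n k _) (ℕₚ.m≤m⊔n (2 * k) w)
  w≤c : w ≤ 2 * k ⊔ w
  w≤c = ℕₚ.m≤n⊔m (2 * k) w
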